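{- Fix positive integers $k,t$. For every $\ell$ with $\alpha(G(n,k,t)) < \ell \le \binom{n}{k}$ we have $$\rho(\ell) \leqslant(1+o(1)) \cdot \frac{\ell^{2}}{n^{t}} \cdot \frac{t!}{2} \cdot \binom{k}{t}^2,$$ where $o(1)\to 0$ as $n\to\infty$.
   Context: For positive integers $n,k,t$, the generalized Johnson graph $G(n,k,t)$ has vertex set $\binom{[n]}{k}$ (all $k$-element subsets of $[n]=\{1,\dots,n\}$), and two $k$-sets $F_1,F_2$ are adjacent iff $|F_1\cap F_2|=t$; $\alpha(G(n,k,t))$ is its independence number. For a family $\mathcal{F}\subset\binom{[n]}{k}$, $\rho(\mathcal{F})$ denotes the number of unordered pairs $\{F_1,F_2\}\subset\mathcal{F}$ with $|F_1\cap F_2|=t$, and $\rho(\ell)=\min\{\rho(\mathcal{F}) : \mathcal{F}\subset\binom{[n]}{k}, |\mathcal{F}|=\ell\}$. -}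

module Defs where

open import Data.Nat using (ℕ; _<_; _≤_; _*_; _+_; _^_)
open import Data.Nat.Properties using (_≟_)
open import Data.Nat.Combinatorics using (_C_)
open import Data.Fin.Subset using (Subset; _∩_; ∣_∣)
open import Data.List using (List; length; filter)
open import Data.List.Relation.Unary.All using (All)
open import Data.List.Relation.Unary.AllPairs using (AllPairs)
open import Data.List.Relation.Unary.Unique.Propositional using (Unique)
open import Data.Product using (_×_; ∃)
open import Relation.Binary.PropositionalEquality using (_≡_)
open import Relation.Nullary using (¬_)

-- A family 𝓕 ⊂ ([n] choose k), represented as a duplicate-free list of
-- k-element subsets of [n] = Fin n.
IsFamily : (n k : ℕ) → List (Subset n) → Set
IsFamily n k 𝓕 = Unique 𝓕 × All (λ A → ∣ A ∣ ≡ k) 𝓕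

ρ : ∀ {n} (t : ℕ) → List (Subset n) → ℕ
ρ t List.[] = 0
ρ t (A List.∷ 𝓕) = length (filter (λ B → ∣ A ∩ B ∣ ≟ t) 𝓕) + ρ t 𝓕

IsIndependent : (n k t : ℕ) → List (Subset n) → Set
IsIndependent n k t 𝓕 = IsFamily n k 𝓕 × AllPairs (λ A B → ¬ (∣ A ∩ B ∣ ≡ t)) 𝓕

-- α(G(n,k,t)) < ℓ : every independent set has fewer than ℓ vertices.
α<_ : ∀ {n k t : ℕ} → ℕ → Set
α<_ {n} {k} {t} ℓ = ∀ (𝓕 : List (Subset n)) → IsIndependent n k t 𝓕 → length 𝓕 < ℓ

-- ρ(ℓ) ≤ x : some family of exactly ℓ k-subsets has ρ(𝓕) ≤ x
-- (ρ(ℓ) is the minimum over such families).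
ρℓ≤ : (n k t ℓ : ℕ) → (ℕ → Set) → Set
ρℓ≤ n k t ℓ P = ∃ λ (𝓕 : List (Subset n)) → IsFamily n k 𝓕 × length 𝓕 ≡ ℓ × P (ρ t 𝓕)

{-# OPTIONS --safe #-}
-- Every k-set A meets at most C(k,t)·C(n,k−t) k-sets in exactly t elements (t common elements
-- inside A, the other k−t anywhere), so by the handshake lemma the family of all C(n,k) k-sets
-- has ρ ≤ ½·C(n,k)·C(k,t)·C(n,k−t).  Every t-intersecting pair of a family of size N survives
-- in N−2 of its N one-member deletions, so some deletion keeps at most the fraction (N−2)/N of
-- them; since (N−2)/N ≤ ((N−1)/N)², the ratio ρ/N² never grows.  Thinning the complete family
-- down to ℓ members thus gives ρ(ℓ) ≤ ℓ²·C(k,t)·C(n,k−t)/(2·C(n,k)), and the quotient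
-- C(n,k−t)/C(n,k) is (1+o(1))·t!·C(k,t)/nᵗ because C(n,j) = (1+o(1))·nʲ/j! for fixed j.
module Submission where

open import Defs
open import Data.Bool using (true; false; _∧_)
open import Data.Fin.Subset using (Subset; _∩_; ∣_∣; inside; outside)
open import Data.Fin.Subset.Properties using (∩-comm; ∣p∩q∣≤∣q∣)
open import Data.List using (List; []; _∷_; [_]; length; filter; map; _++_)
open import Data.List.Properties
  using (length-map; length-++; map-cong; filter-++; filter-none; filter-accept; filter-reject)
open import Data.List.Membership.Propositional using (_∈_)
open import Data.List.Membership.Propositional.Properties using (∈-map⁻)
open import Data.List.Relation.Binary.Disjoint.Propositional using (Disjoint)
open import Data.List.Relation.Unary.All as All using (All; []; _∷_)
import Data.List.Relation.Unary.All.Properties as All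
open import Data.List.Relation.Unary.AllPairs using (AllPairs; []; _∷_)
open import Data.List.Relation.Unary.Any using (here; there)
open import Data.List.Relation.Unary.Unique.Propositional using (Unique)
import Data.List.Relation.Unary.Unique.Propositional.Properties as Unique
open import Data.Nat
open import Data.Nat.Combinatorics using (_C_; nCk+nC[k+1]≡[n+1]C[k+1]; k>n⇒nCk≡0; nC1≡n)
open import Data.Nat.ListAction using (sum)
open import Data.Nat.Properties
open import Data.Nat.Tactic.RingSolver using (solve-∀)
open import Data.Product using (_×_; _,_; ∃)
open import Data.Vec using ([]; _∷_)
open import Data.Vec.Properties using (∷-injectiveʳ)
open import Function using (_∘_)
open import Level using (0ℓ)
open import Relation.Binary using (Rel)
open import Relation.Binary.PropositionalEquality
  using (_≡_; _≢_; refl; sym; trans; cong; cong₂; subst; module ≡-Reasoning)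
open import Relation.Nullary using (yes; no; does)
open import Relation.Unary using (Pred; Decidable)
open import Algebra.Properties.CommutativeSemigroup +-commutativeSemigroup
  using () renaming (interchange to +-interchange)
open import Algebra.Properties.CommutativeSemigroup *-commutativeSemigroup
  using (x∙yz≈y∙xz; x∙yz≈yx∙z; xy∙z≈y∙xz) renaming (interchange to *-interchange)

private variable n : ℕ

-- Binomial coefficients

-- Unlike _C_ (defined by division), this unfolds by Pascal's rule in the inductions below.
infixl 6.5 _choose_

_choose_ : ℕ → ℕ → ℕ
n     choose zero  = 1
zero  choose suc k = 0
suc n choose suc k = n choose k + n choose suc k

choose≡C : ∀ n k → n choose k ≡ n C k
choose≡C n       zero    = refl
choose≡C zero    (suc k) = sym (k>n⇒nCk≡0 {0} {suc k} (s≤s z≤n))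
choose≡C (suc n) (suc k) =
  trans (cong₂ _+_ (choose≡C n k) (choose≡C n (suc k))) (nCk+nC[k+1]≡[n+1]C[k+1] n k)

choose-vanishes : ∀ {n k} → n < k → n choose k ≡ 0
choose-vanishes {n} {k} n<k = trans (choose≡C n k) (k>n⇒nCk≡0 n<k)

choose-positive : ∀ {n k} → k ≤ n → 0 < n choose k
choose-positive {k = zero}  _         = s≤s z≤n
choose-positive {k = suc k} (s≤s k≤n) = ≤-trans (choose-positive k≤n) (m≤m+n _ _)

k≤n⇒0<nCk : ∀ {n k} → k ≤ n → 0 < n C k
k≤n⇒0<nCk {n} {k} k≤n = subst (0 <_) (choose≡C n k) (choose-positive k≤n)

choose-suc-monoˡ : ∀ n k → n choose k ≤ suc n choose k
choose-suc-monoˡ n zero    = ≤-refl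
choose-suc-monoˡ n (suc k) = m≤n+m _ _

choose-absorb : ∀ n k → suc k * (suc n choose suc k) ≡ suc n * (n choose k)
choose-absorb zero    zero    = refl
choose-absorb zero    (suc k) = *-zeroʳ (2 + k)
choose-absorb (suc n) zero    = begin
  1 * (1 + suc n choose 1) ≡⟨ *-identityˡ _ ⟩
  1 + suc n choose 1       ≡⟨ cong suc (trans (choose≡C (suc n) 1) (nC1≡n (suc n))) ⟩
  2 + n                    ≡⟨ *-identityʳ (2 + n) ⟨
  (2 + n) * 1              ∎
  where open ≡-Reasoning
choose-absorb (suc n) (suc k) = begin
  (2 + k) * (a + b)                    ≡⟨ expand k a b ⟩
  (1 + k) * a + a + (2 + k) * b
    ≡⟨ cong₂ (λ x y → x + a + y) (choose-absorb n k) (choose-absorb n (suc k)) ⟩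
  (1 + n) * c + (c + d) + (1 + n) * d  ≡⟨ collect n c d ⟩
  (2 + n) * (c + d)                    ∎
  where
  open ≡-Reasoning
  a = suc n choose suc k
  b = suc n choose suc (suc k)
  c = n choose k
  d = n choose suc k
  expand : ∀ k a b → (2 + k) * (a + b) ≡ (1 + k) * a + a + (2 + k) * b
  expand = solve-∀
  collect : ∀ n c d → (1 + n) * c + (c + d) + (1 + n) * d ≡ (2 + n) * (c + d)
  collect = solve-∀

factorial*choose≤^ : ∀ n k → k ! * (n choose k) ≤ n ^ k
factorial*choose≤^ n       zero    = ≤-refl
factorial*choose≤^ zero    (suc k) = ≤-reflexive (*-zeroʳ (suc k !))
factorial*choose≤^ (suc n) (suc k) = begin
  suc k ! * (suc n choose suc k)      ≡⟨ xy∙z≈y∙xz (suc k) (k !) _ ⟩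
  k ! * (suc k * (suc n choose suc k)) ≡⟨ cong (k ! *_) (choose-absorb n k) ⟩
  k ! * (suc n * (n choose k))        ≡⟨ x∙yz≈y∙xz (k !) (suc n) _ ⟩
  suc n * (k ! * (n choose k))        ≤⟨ *-monoʳ-≤ (suc n) (factorial*choose≤^ n k) ⟩
  suc n * n ^ k                       ≤⟨ *-monoʳ-≤ (suc n) (^-monoˡ-≤ k (n≤1+n n)) ⟩
  suc n * suc n ^ k                   ∎
  where open ≤-Reasoning

^≤factorial*choose : ∀ x k → x ^ k ≤ k ! * ((x + k) choose k)
^≤factorial*choose x zero    = ≤-refl
^≤factorial*choose x (suc k) = begin
  x * x ^ k                                  ≤⟨ *-mono-≤ (m≤n⇒m≤1+n (m≤m+n x k)) (^≤factorial*choose x k) ⟩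
  suc (x + k) * (k ! * ((x + k) choose k))   ≡⟨ x∙yz≈y∙xz (suc (x + k)) (k !) _ ⟩
  k ! * (suc (x + k) * ((x + k) choose k))   ≡⟨ cong (k ! *_) (choose-absorb (x + k) k) ⟨
  k ! * (suc k * (suc (x + k) choose suc k)) ≡⟨ x∙yz≈yx∙z (k !) (suc k) _ ⟩
  suc k ! * (suc (x + k) choose suc k)       ≡⟨ cong (λ y → suc k ! * (y choose suc k)) (+-suc x k) ⟨
  suc k ! * ((x + suc k) choose suc k)       ∎
  where open ≤-Reasoning

factorial-split : ∀ t j → t ! * ((t + j) choose t) * j ! ≡ (t + j) !
factorial-split zero    j = +-identityʳ (j !)
factorial-split (suc t) j = begin
  suc t ! * (suc (t + j) choose suc t) * j !         ≡⟨ cong (_* j !) (xy∙z≈y∙xz (suc t) (t !) _) ⟩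
  t ! * (suc t * (suc (t + j) choose suc t)) * j !   ≡⟨ cong (λ y → t ! * y * j !) (choose-absorb (t + j) t) ⟩
  t ! * (suc (t + j) * ((t + j) choose t)) * j !     ≡⟨ cong (_* j !) (x∙yz≈y∙xz (t !) (suc (t + j)) _) ⟩
  suc (t + j) * (t ! * ((t + j) choose t)) * j !     ≡⟨ *-assoc (suc (t + j)) (t ! * ((t + j) choose t)) (j !) ⟩
  suc (t + j) * (t ! * ((t + j) choose t) * j !)     ≡⟨ cong (suc (t + j) *_) (factorial-split t j) ⟩
  suc (t + j) * (t + j) !                            ∎
  where open ≡-Reasoning

^-increment-≤ : ∀ b d s → (b + d) ^ suc s ≤ b ^ suc s + suc s * d * (b + d) ^ s
^-increment-≤ b d zero    = ≤-reflexive (base b d)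
  where
  base : ∀ b d → (b + d) * 1 ≡ b * 1 + 1 * d * 1
  base = solve-∀
^-increment-≤ b d (suc s) = begin
  (b + d) * (b + d) ^ suc s                                 ≤⟨ *-monoʳ-≤ (b + d) (^-increment-≤ b d s) ⟩
  (b + d) * (b ^ suc s + suc s * d * (b + d) ^ s)           ≡⟨ expand b d (b ^ suc s) (suc s) ((b + d) ^ s) ⟩
  b * b ^ suc s + d * b ^ suc s + suc s * d * (b + d) ^ suc s
    ≤⟨ +-monoˡ-≤ _ (+-monoʳ-≤ (b * b ^ suc s) (*-monoʳ-≤ d (^-monoˡ-≤ (suc s) (m≤m+n b d)))) ⟩
  b * b ^ suc s + d * (b + d) ^ suc s + suc s * d * (b + d) ^ suc s
    ≡⟨ collect (b * b ^ suc s) d ((b + d) ^ suc s) (suc s) ⟩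
  b * b ^ suc s + suc (suc s) * d * (b + d) ^ suc s         ∎
  where
  open ≤-Reasoning
  expand : ∀ b d x s y → (b + d) * (x + s * d * y) ≡ b * x + d * x + s * d * ((b + d) * y)
  expand = solve-∀
  collect : ∀ x d y s → x + d * y + s * d * y ≡ x + (1 + s) * d * y
  collect = solve-∀

^-slack-≤ : ∀ m b d s → suc (suc m) * s * d ≤ b + d → suc m * (b + d) ^ s ≤ suc (suc m) * b ^ s
^-slack-≤ m b d zero    _    = *-monoˡ-≤ 1 (n≤1+n (suc m))
^-slack-≤ m b d (suc s) s*d≤ = +-cancelʳ-≤ P (suc m * P) (M * b ^ suc s) (begin
  suc m * P + P                                   ≡⟨ +-comm (suc m * P) P ⟩
  M * P                                           ≤⟨ *-monoʳ-≤ M (^-increment-≤ b d s) ⟩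
  M * (b ^ suc s + suc s * d * (b + d) ^ s)       ≡⟨ distribute M (b ^ suc s) (suc s) d ((b + d) ^ s) ⟩
  M * b ^ suc s + M * suc s * d * (b + d) ^ s     ≤⟨ +-monoʳ-≤ (M * b ^ suc s) (*-monoˡ-≤ ((b + d) ^ s) s*d≤) ⟩
  M * b ^ suc s + P                               ∎)
  where
  open ≤-Reasoning
  M = suc (suc m)
  P = (b + d) ^ suc s
  distribute : ∀ M x s d y → M * (x + s * d * y) ≡ M * x + M * s * d * y
  distribute = solve-∀

choose-asymptotics : ∀ m k n → suc (suc m) * k * k + k ≤ n →
                     suc m * n ^ k ≤ suc (suc m) * (k ! * (n choose k))
choose-asymptotics m k n N≤n =
  subst (λ n → suc m * n ^ k ≤ suc (suc m) * (k ! * (n choose k))) (m∸n+n≡m k≤n) (begin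
    suc m * (b + k) ^ k                     ≤⟨ ^-slack-≤ m b k k (≤-trans slack (m≤m+n b k)) ⟩
    suc (suc m) * b ^ k                     ≤⟨ *-monoʳ-≤ (suc (suc m)) (^≤factorial*choose b k) ⟩
    suc (suc m) * (k ! * ((b + k) choose k)) ∎)
  where
  open ≤-Reasoning
  b = n ∸ k
  k≤n : k ≤ n
  k≤n = ≤-trans (m≤n+m k _) N≤n
  slack : suc (suc m) * k * k ≤ b
  slack = subst (_≤ b) (m+n∸n≡m _ k) (∸-monoˡ-≤ k N≤n)

choose-ratio-asymptotics : ∀ m t j n → suc (suc m) * (t + j) * (t + j) + (t + j) ≤ n →
  suc m * n ^ t * (n choose j) ≤ suc (suc m) * (t ! * ((t + j) choose t)) * (n choose (t + j))
choose-ratio-asymptotics m t j n N≤n = *-cancelʳ-≤ _ _ (j !) (begin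
  suc m * n ^ t * (n choose j) * j !                ≡⟨ regroup (suc m * n ^ t) (n choose j) (j !) ⟩
  suc m * n ^ t * (j ! * (n choose j))              ≤⟨ *-monoʳ-≤ (suc m * n ^ t) (factorial*choose≤^ n j) ⟩
  suc m * n ^ t * n ^ j                             ≡⟨ *-assoc (suc m) (n ^ t) (n ^ j) ⟩
  suc m * (n ^ t * n ^ j)                           ≡⟨ cong (suc m *_) (^-distribˡ-+-* n t j) ⟨
  suc m * n ^ (t + j)                               ≤⟨ choose-asymptotics m (t + j) n N≤n ⟩
  M * ((t + j) ! * (n choose (t + j)))
    ≡⟨ cong (λ x → M * (x * (n choose (t + j)))) (factorial-split t j) ⟨
  M * (t ! * ((t + j) choose t) * j ! * (n choose (t + j)))
    ≡⟨ regroup′ M (t ! * ((t + j) choose t)) (j !) (n choose (t + j)) ⟩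
  M * (t ! * ((t + j) choose t)) * (n choose (t + j)) * j ! ∎)
  where
  open ≤-Reasoning
  instance _ = j !≢0
  M = suc (suc m)
  regroup : ∀ x y z → x * y * z ≡ x * (z * y)
  regroup = solve-∀
  regroup′ : ∀ M x y z → M * (x * y * z) ≡ M * x * z * y
  regroup′ = solve-∀

degree-asymptotics : ∀ m k t n → suc (suc m) * k * k + k ≤ n →
  suc m * n ^ t * ((k C t) * (n C (k ∸ t))) ≤ suc (suc m) * t ! * ((k C t) * (k C t)) * (n C k)
degree-asymptotics m k t n N≤n
  rewrite sym (choose≡C k t) | sym (choose≡C n (k ∸ t)) | sym (choose≡C n k)
  with t ≤? k
... | no t≰k rewrite choose-vanishes (≰⇒> t≰k) | *-zeroʳ (suc m * n ^ t) = z≤n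
... | yes t≤k with k ∸ t | m+[n∸m]≡n t≤k
...   | j | refl = begin
  suc m * n ^ t * (B * (n choose j))          ≡⟨ x∙yz≈y∙xz (suc m * n ^ t) B _ ⟩
  B * (suc m * n ^ t * (n choose j))          ≤⟨ *-monoʳ-≤ B (choose-ratio-asymptotics m t j n N≤n) ⟩
  B * (M * (t ! * B) * (n choose (t + j)))    ≡⟨ regroup B M (t !) (n choose (t + j)) ⟩
  M * t ! * (B * B) * (n choose (t + j))      ∎
  where
  open ≤-Reasoning
  M = suc (suc m)
  B = (t + j) choose t
  regroup : ∀ b M f c → b * (M * (f * b) * c) ≡ M * f * (b * b) * c
  regroup = solve-∀

-- Degrees in the family of all k-subsets

degree : ℕ → Subset n → List (Subset n) → ℕ
degree t A 𝓕 = length (filter (λ B → ∣ A ∩ B ∣ ≟ t) 𝓕)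

subsets : ∀ n → ℕ → List (Subset n)
subsets zero    zero    = [ [] ]
subsets zero    (suc k) = []
subsets (suc n) zero    = map (outside ∷_) (subsets n zero)
subsets (suc n) (suc k) = map (inside ∷_) (subsets n k) ++ map (outside ∷_) (subsets n (suc k))

length-subsets : ∀ n k → length (subsets n k) ≡ n choose k
length-subsets zero    zero    = refl
length-subsets zero    (suc k) = refl
length-subsets (suc n) zero    = trans (length-map _ (subsets n zero)) (length-subsets n zero)
length-subsets (suc n) (suc k) = begin
  length (map (inside ∷_) (subsets n k) ++ map (outside ∷_) (subsets n (suc k)))
    ≡⟨ length-++ (map (inside ∷_) (subsets n k)) ⟩
  length (map (inside ∷_) (subsets n k)) + length (map (outside ∷_) (subsets n (suc k)))
    ≡⟨ cong₂ _+_ (length-map _ (subsets n k)) (length-map _ (subsets n (suc k))) ⟩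
  length (subsets n k) + length (subsets n (suc k))
    ≡⟨ cong₂ _+_ (length-subsets n k) (length-subsets n (suc k)) ⟩
  n choose k + n choose suc k ∎
  where open ≡-Reasoning

subsets-size : ∀ n k → All (λ A → ∣ A ∣ ≡ k) (subsets n k)
subsets-size zero    zero    = refl ∷ []
subsets-size zero    (suc k) = []
subsets-size (suc n) zero    = All.map⁺ (subsets-size n zero)
subsets-size (suc n) (suc k) =
  All.++⁺ (All.map⁺ (All.map (cong suc) (subsets-size n k))) (All.map⁺ (subsets-size n (suc k)))

subsets-unique : ∀ n k → Unique (subsets n k)
subsets-unique zero    zero    = [] ∷ []
subsets-unique zero    (suc k) = []
subsets-unique (suc n) zero    = Unique.map⁺ ∷-injectiveʳ (subsets-unique n zero)
subsets-unique (suc n) (suc k) = Unique.++⁺ (Unique.map⁺ ∷-injectiveʳ (subsets-unique n k))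
                                            (Unique.map⁺ ∷-injectiveʳ (subsets-unique n (suc k)))
                                            heads-differ
  where
  heads-differ : Disjoint (map (inside ∷_) (subsets n k)) (map (outside ∷_) (subsets n (suc k)))
  heads-differ (A∈ , A∈′) with ∈-map⁻ (inside ∷_) A∈ | ∈-map⁻ (outside ∷_) A∈′
  ... | _ , _ , refl | _ , _ , ()

subsets-family : ∀ n k → IsFamily n k (subsets n k)
subsets-family n k = subsets-unique n k , subsets-size n k

length-filter-map : ∀ {A B : Set} {P : Pred B 0ℓ} {Q : Pred A 0ℓ} (P? : Decidable P) (Q? : Decidable Q)
                    (f : A → B) → (∀ x → does (P? (f x)) ≡ does (Q? x)) →
                    ∀ xs → length (filter P? (map f xs)) ≡ length (filter Q? xs)
length-filter-map P? Q? f same []       = refl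
length-filter-map P? Q? f same (x ∷ xs) with does (P? (f x)) | does (Q? x) | same x
... | true  | true  | refl = cong suc (length-filter-map P? Q? f same xs)
... | false | false | refl = length-filter-map P? Q? f same xs

degree-++ : ∀ t (A : Subset n) 𝓕 𝓖 → degree t A (𝓕 ++ 𝓖) ≡ degree t A 𝓕 + degree t A 𝓖
degree-++ t A 𝓕 𝓖 = trans (cong length (filter-++ (λ B → ∣ A ∩ B ∣ ≟ t) 𝓕 𝓖)) (length-++ (filter _ 𝓕))

degree-head-∉ : ∀ {t} x y (A : Subset n) 𝓕 → x ∧ y ≡ false →
                degree t (x ∷ A) (map (y ∷_) 𝓕) ≡ degree t A 𝓕
degree-head-∉ outside y      A 𝓕 _ = length-filter-map _ _ _ (λ _ → refl) 𝓕
degree-head-∉ inside outside A 𝓕 _ = length-filter-map _ _ _ (λ _ → refl) 𝓕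

degree-head-∈ : ∀ t (A : Subset n) 𝓕 → degree (suc t) (inside ∷ A) (map (inside ∷_) 𝓕) ≡ degree t A 𝓕
degree-head-∈ t A = length-filter-map _ _ _ (λ _ → refl)

degree-head-∈-zero : ∀ (A : Subset n) 𝓕 → degree 0 (inside ∷ A) (map (inside ∷_) 𝓕) ≡ 0
degree-head-∈-zero A 𝓕 = cong length (filter-none _ (All.map⁺ (All.universal (λ _ ()) 𝓕)))

degree-vanishes : ∀ {k t} (A : Subset n) → k < t → degree t A (subsets n k) ≡ 0
degree-vanishes {n} {k} {t} A k<t = cong length (filter-none _ (All.map too-small (subsets-size n k)))
  where
  too-small : ∀ {B} → ∣ B ∣ ≡ k → ∣ A ∩ B ∣ ≢ t
  too-small {B} refl = <⇒≢ (≤-<-trans (∣p∩q∣≤∣q∣ A B) k<t)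

degree-outside∷ : ∀ t k (A : Subset n) → degree t (outside ∷ A) (subsets (suc n) (suc k)) ≡
                  degree t A (subsets n k) + degree t A (subsets n (suc k))
degree-outside∷ {n} t k A = trans (degree-++ t (outside ∷ A) (map (inside ∷_) (subsets n k)) _)
  (cong₂ _+_ (degree-head-∉ outside inside A (subsets n k) refl)
             (degree-head-∉ outside outside A (subsets n (suc k)) refl))

degree-inside∷ : ∀ t k (A : Subset n) → degree (suc t) (inside ∷ A) (subsets (suc n) (suc k)) ≡
                 degree t A (subsets n k) + degree (suc t) A (subsets n (suc k))
degree-inside∷ {n} t k A = trans (degree-++ (suc t) (inside ∷ A) (map (inside ∷_) (subsets n k)) _)
  (cong₂ _+_ (degree-head-∈ t A (subsets n k))
             (degree-head-∉ inside outside A (subsets n (suc k)) refl))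

degree-inside∷-zero : ∀ k (A : Subset n) → degree 0 (inside ∷ A) (subsets (suc n) (suc k)) ≡
                      degree 0 A (subsets n (suc k))
degree-inside∷-zero {n} k A = trans (degree-++ 0 (inside ∷ A) (map (inside ∷_) (subsets n k)) _)
  (cong₂ _+_ (degree-head-∈-zero A (subsets n k))
             (degree-head-∉ inside outside A (subsets n (suc k)) refl))

DegreeBound : Subset n → Set
DegreeBound {n} A = ∀ j t → degree t A (subsets n (j + t)) ≤ (∣ A ∣ choose t) * (n choose j)

degree-bound-outside∷ : ∀ {A : Subset n} → DegreeBound A → DegreeBound (outside ∷ A)
degree-bound-outside∷ {n} {A} ih zero zero =
  ≤-trans (≤-reflexive (degree-head-∉ outside outside A (subsets n 0) refl)) (ih zero zero)
degree-bound-outside∷ {n} {A} ih zero (suc t) = begin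
  degree (suc t) (outside ∷ A) (subsets (suc n) (suc t))                 ≡⟨ degree-outside∷ (suc t) t A ⟩
  degree (suc t) A (subsets n t) + degree (suc t) A (subsets n (suc t))
    ≡⟨ cong (_+ degree (suc t) A (subsets n (suc t))) (degree-vanishes A (n<1+n t)) ⟩
  degree (suc t) A (subsets n (suc t))                                   ≤⟨ ih zero (suc t) ⟩
  (∣ A ∣ choose suc t) * 1                                               ∎
  where open ≤-Reasoning
degree-bound-outside∷ {n} {A} ih (suc j) t = begin
  degree t (outside ∷ A) (subsets (suc n) (suc (j + t)))                 ≡⟨ degree-outside∷ t (j + t) A ⟩
  degree t A (subsets n (j + t)) + degree t A (subsets n (suc j + t))    ≤⟨ +-mono-≤ (ih j t) (ih (suc j) t) ⟩
  (∣ A ∣ choose t) * (n choose j) + (∣ A ∣ choose t) * (n choose suc j)  ≡⟨ *-distribˡ-+ (∣ A ∣ choose t) (n choose j) _ ⟨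
  (∣ A ∣ choose t) * (suc n choose suc j)                                ∎
  where open ≤-Reasoning

degree-bound-inside∷ : ∀ {A : Subset n} → DegreeBound A → DegreeBound (inside ∷ A)
degree-bound-inside∷ {n} {A} ih zero zero =
  ≤-trans (≤-reflexive (degree-head-∉ inside outside A (subsets n 0) refl)) (ih zero zero)
degree-bound-inside∷ {n} {A} ih zero (suc t) = begin
  degree (suc t) (inside ∷ A) (subsets (suc n) (suc t))                  ≡⟨ degree-inside∷ t t A ⟩
  degree t A (subsets n t) + degree (suc t) A (subsets n (suc t))        ≤⟨ +-mono-≤ (ih zero t) (ih zero (suc t)) ⟩
  (∣ A ∣ choose t) * 1 + (∣ A ∣ choose suc t) * 1                        ≡⟨ *-distribʳ-+ 1 (∣ A ∣ choose t) _ ⟨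
  (suc ∣ A ∣ choose suc t) * 1                                           ∎
  where open ≤-Reasoning
degree-bound-inside∷ {n} {A} ih (suc j) zero = begin
  degree 0 (inside ∷ A) (subsets (suc n) (suc (j + 0)))                  ≡⟨ degree-inside∷-zero (j + 0) A ⟩
  degree 0 A (subsets n (suc j + 0))                                     ≤⟨ ih (suc j) 0 ⟩
  1 * (n choose suc j)                                                   ≤⟨ *-monoʳ-≤ 1 (choose-suc-monoˡ n (suc j)) ⟩
  1 * (suc n choose suc j)                                               ∎
  where open ≤-Reasoning
degree-bound-inside∷ {n} {A} ih (suc j) (suc t) = begin
  degree (suc t) (inside ∷ A) (subsets (suc n) (suc (j + suc t)))        ≡⟨ degree-inside∷ t (j + suc t) A ⟩
  degree t A (subsets n (j + suc t)) + degree (suc t) A (subsets n (suc j + suc t))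
    ≡⟨ cong (λ k → degree t A (subsets n k) + degree (suc t) A (subsets n (suc j + suc t))) (+-suc j t) ⟩
  degree t A (subsets n (suc j + t)) + degree (suc t) A (subsets n (suc j + suc t))
    ≤⟨ +-mono-≤ (ih (suc j) t) (ih (suc j) (suc t)) ⟩
  (∣ A ∣ choose t) * (n choose suc j) + (∣ A ∣ choose suc t) * (n choose suc j)
    ≡⟨ *-distribʳ-+ (n choose suc j) (∣ A ∣ choose t) _ ⟨
  (suc ∣ A ∣ choose suc t) * (n choose suc j)
    ≤⟨ *-monoʳ-≤ (suc ∣ A ∣ choose suc t) (choose-suc-monoˡ n (suc j)) ⟩
  (suc ∣ A ∣ choose suc t) * (suc n choose suc j)                        ∎
  where open ≤-Reasoning

degree-bound′ : ∀ (A : Subset n) → DegreeBound A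
degree-bound′ []            zero    zero    = ≤-refl
degree-bound′ []            zero    (suc t) = z≤n
degree-bound′ []            (suc j) t       = z≤n
degree-bound′ (outside ∷ A) = degree-bound-outside∷ (degree-bound′ A)
degree-bound′ (inside ∷ A)  = degree-bound-inside∷ (degree-bound′ A)

degree-bound : ∀ {k t} (A : Subset n) → degree t A (subsets n k) ≤ (∣ A ∣ choose t) * (n choose (k ∸ t))
degree-bound {n} {k} {t} A with t ≤? k
... | yes t≤k = subst (λ k′ → degree t A (subsets n k′) ≤ (∣ A ∣ choose t) * (n choose (k ∸ t)))
                      (m∸n+n≡m t≤k) (degree-bound′ A (k ∸ t) t)
... | no  t≰k = subst (_≤ (∣ A ∣ choose t) * (n choose (k ∸ t))) (sym (degree-vanishes A (≰⇒> t≰k))) z≤n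

degree-sym : ∀ t (A B : Subset n) → degree t A [ B ] ≡ degree t B [ A ]
degree-sym t A B with ∣ A ∩ B ∣ ≟ t
... | yes A∩B≡t = trans (cong length (filter-accept (λ C → ∣ A ∩ C ∣ ≟ t) A∩B≡t))
  (sym (cong length (filter-accept (λ C → ∣ B ∩ C ∣ ≟ t) (trans (cong ∣_∣ (∩-comm B A)) A∩B≡t))))
... | no  A∩B≢t = trans (cong length (filter-reject (λ C → ∣ A ∩ C ∣ ≟ t) A∩B≢t))
  (sym (cong length (filter-reject (λ C → ∣ B ∩ C ∣ ≟ t) (A∩B≢t ∘ trans (cong ∣_∣ (∩-comm A B))))))

sum-degree-singleton : ∀ t (B : Subset n) 𝓕 → sum (map (λ A → degree t A [ B ]) 𝓕) ≡ degree t B 𝓕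
sum-degree-singleton t B []      = refl
sum-degree-singleton t B (A ∷ 𝓕) = begin
  degree t A [ B ] + sum (map (λ A → degree t A [ B ]) 𝓕)
    ≡⟨ cong₂ _+_ (degree-sym t A B) (sum-degree-singleton t B 𝓕) ⟩
  degree t B [ A ] + degree t B 𝓕                           ≡⟨ degree-++ t B [ A ] 𝓕 ⟨
  degree t B (A ∷ 𝓕)                                        ∎
  where open ≡-Reasoning

sum-map-+ : ∀ {A : Set} (f g : A → ℕ) xs → sum (map (λ x → f x + g x) xs) ≡ sum (map f xs) + sum (map g xs)
sum-map-+ f g []       = refl
sum-map-+ f g (x ∷ xs) = trans (cong (f x + g x +_) (sum-map-+ f g xs)) (+-interchange (f x) (g x) _ _)

sum-map-≤ : ∀ {A : Set} (f : A → ℕ) {D} {xs} → All (λ x → f x ≤ D) xs → sum (map f xs) ≤ length xs * D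
sum-map-≤ f []         = z≤n
sum-map-≤ f (fx≤ ∷ ps) = +-mono-≤ fx≤ (sum-map-≤ f ps)

-- Only ≤: degree t A 𝓕 also counts A itself when ∣ A ∣ ≡ t.
handshake : ∀ t (𝓕 : List (Subset n)) → 2 * ρ t 𝓕 ≤ sum (map (λ A → degree t A 𝓕) 𝓕)
handshake t []      = z≤n
handshake t (B ∷ 𝓕) = begin
  2 * (d + ρ t 𝓕)                                          ≡⟨ double d (ρ t 𝓕) ⟩
  d + (d + 2 * ρ t 𝓕)
    ≤⟨ +-mono-≤ (m≤n+m d (degree t B [ B ])) (+-monoʳ-≤ d (handshake t 𝓕)) ⟩
  degree t B [ B ] + d + (d + Σ𝓕)
    ≡⟨ cong₂ _+_ (degree-++ t B [ B ] 𝓕) (cong (_+ Σ𝓕) (sum-degree-singleton t B 𝓕)) ⟨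
  degree t B (B ∷ 𝓕) + (sum (map (λ A → degree t A [ B ]) 𝓕) + Σ𝓕)
    ≡⟨ cong (degree t B (B ∷ 𝓕) +_) (sum-map-+ (λ A → degree t A [ B ]) (λ A → degree t A 𝓕) 𝓕) ⟨
  degree t B (B ∷ 𝓕) + sum (map (λ A → degree t A [ B ] + degree t A 𝓕) 𝓕)
    ≡⟨ cong (λ xs → degree t B (B ∷ 𝓕) + sum xs) (map-cong (λ A → degree-++ t A [ B ] 𝓕) 𝓕) ⟨
  degree t B (B ∷ 𝓕) + sum (map (λ A → degree t A (B ∷ 𝓕)) 𝓕) ∎
  where
  open ≤-Reasoning
  d = degree t B 𝓕
  Σ𝓕 = sum (map (λ A → degree t A 𝓕) 𝓕)
  double : ∀ a b → 2 * (a + b) ≡ a + (a + 2 * b)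
  double = solve-∀

ρ-subsets : ∀ n k t → 2 * ρ t (subsets n k) ≤ (n choose k) * ((k choose t) * (n choose (k ∸ t)))
ρ-subsets n k t = begin
  2 * ρ t (subsets n k)                                    ≤⟨ handshake t (subsets n k) ⟩
  sum (map (λ A → degree t A (subsets n k)) (subsets n k))
    ≤⟨ sum-map-≤ (λ A → degree t A (subsets n k)) (All.map (λ {A} → bound A) (subsets-size n k)) ⟩
  length (subsets n k) * D                                 ≡⟨ cong (_* D) (length-subsets n k) ⟩
  (n choose k) * D                                         ∎
  where
  open ≤-Reasoning
  D = (k choose t) * (n choose (k ∸ t))
  bound : ∀ A → ∣ A ∣ ≡ k → degree t A (subsets n k) ≤ D
  bound A refl = degree-bound A

-- Thinning a family by deletions

deletions : ∀ {A : Set} → List A → List (List A)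
deletions []       = []
deletions (x ∷ xs) = xs ∷ map (x ∷_) (deletions xs)

length-deletions : ∀ {A : Set} (xs : List A) → length (deletions xs) ≡ length xs
length-deletions []       = refl
length-deletions (x ∷ xs) = cong suc (trans (length-map (x ∷_) (deletions xs)) (length-deletions xs))

∈-deletions⇒length : ∀ {A : Set} {xs ys : List A} → ys ∈ deletions xs → suc (length ys) ≡ length xs
∈-deletions⇒length {xs = x ∷ xs} (here refl) = refl
∈-deletions⇒length {xs = x ∷ xs} (there ys∈) with ∈-map⁻ (x ∷_) ys∈
... | zs , zs∈ , refl = cong suc (∈-deletions⇒length zs∈)

All-deletions : ∀ {A : Set} {P : Pred A 0ℓ} {xs ys : List A} → ys ∈ deletions xs → All P xs → All P ys
All-deletions {xs = x ∷ xs} (here refl) (px ∷ pxs) = pxs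
All-deletions {xs = x ∷ xs} (there ys∈) (px ∷ pxs) with ∈-map⁻ (x ∷_) ys∈
... | zs , zs∈ , refl = px ∷ All-deletions zs∈ pxs

AllPairs-deletions : ∀ {A : Set} {R : Rel A 0ℓ} {xs ys : List A} →
                     ys ∈ deletions xs → AllPairs R xs → AllPairs R ys
AllPairs-deletions {xs = x ∷ xs} (here refl) (rx ∷ rxs) = rxs
AllPairs-deletions {xs = x ∷ xs} (there ys∈) (rx ∷ rxs) with ∈-map⁻ (x ∷_) ys∈
... | zs , zs∈ , refl = All-deletions zs∈ rx ∷ AllPairs-deletions zs∈ rxs

IsFamily-deletions : ∀ {k} {𝓕 𝓖 : List (Subset n)} →
                     𝓖 ∈ deletions 𝓕 → IsFamily n k 𝓕 → IsFamily n k 𝓖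
IsFamily-deletions 𝓖∈ (unique , sizes) = AllPairs-deletions 𝓖∈ unique , All-deletions 𝓖∈ sizes

length-filter-∷ : ∀ {A : Set} {P : Pred A 0ℓ} (P? : Decidable P) x xs →
                  length (filter P? (x ∷ xs)) ≡ length (filter P? [ x ]) + length (filter P? xs)
length-filter-∷ P? x xs = trans (cong length (filter-++ P? [ x ] xs)) (length-++ (filter P? [ x ]))

sum-length-filter-map-∷ : ∀ {A : Set} {P : Pred A 0ℓ} (P? : Decidable P) x (yss : List (List A)) →
  sum (map (λ ys → length (filter P? ys)) (map (x ∷_) yss)) ≡
  length yss * length (filter P? [ x ]) + sum (map (λ ys → length (filter P? ys)) yss)
sum-length-filter-map-∷ P? x []         = refl
sum-length-filter-map-∷ P? x (ys ∷ yss) =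
  trans (cong₂ _+_ (length-filter-∷ P? x ys) (sum-length-filter-map-∷ P? x yss))
        (+-interchange (length (filter P? [ x ])) _ _ _)

length-filter-deletions : ∀ {A : Set} {P : Pred A 0ℓ} (P? : Decidable P) xs →
  sum (map (λ ys → length (filter P? ys)) (deletions xs)) + length (filter P? xs) ≡ length xs * length (filter P? xs)
length-filter-deletions P? []       = refl
length-filter-deletions P? (y ∷ zs) = begin
  c zs + sum (map c (map (y ∷_) (deletions zs))) + c (y ∷ zs)
    ≡⟨ cong₂ (λ u v → c zs + u + v) (sum-length-filter-map-∷ P? y (deletions zs)) (length-filter-∷ P? y zs) ⟩
  c zs + (length (deletions zs) * c [ y ] + Σc) + (c [ y ] + c zs)
    ≡⟨ cong (λ l → c zs + (l * c [ y ] + Σc) + (c [ y ] + c zs)) (length-deletions zs) ⟩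
  c zs + (length zs * c [ y ] + Σc) + (c [ y ] + c zs)
    ≡⟨ regroup (c zs) (length zs * c [ y ]) Σc (c [ y ]) ⟩
  c zs + length zs * c [ y ] + (Σc + c zs) + c [ y ]
    ≡⟨ cong (λ u → c zs + length zs * c [ y ] + u + c [ y ]) (length-filter-deletions P? zs) ⟩
  c zs + length zs * c [ y ] + length zs * c zs + c [ y ]
    ≡⟨ collect (length zs) (c [ y ]) (c zs) ⟩
  suc (length zs) * (c [ y ] + c zs)
    ≡⟨ cong (suc (length zs) *_) (length-filter-∷ P? y zs) ⟨
  suc (length zs) * c (y ∷ zs) ∎
  where
  open ≡-Reasoning
  c = λ ys → length (filter P? ys)
  Σc = sum (map c (deletions zs))
  regroup : ∀ a b s e → a + (b + s) + (e + a) ≡ a + b + (s + a) + e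
  regroup = solve-∀
  collect : ∀ l e a → a + l * e + l * a + e ≡ suc l * (e + a)
  collect = solve-∀

sum-ρ-map-∷ : ∀ t (A : Subset n) 𝓖s →
              sum (map (ρ t) (map (A ∷_) 𝓖s)) ≡ sum (map (degree t A) 𝓖s) + sum (map (ρ t) 𝓖s)
sum-ρ-map-∷ t A []       = refl
sum-ρ-map-∷ t A (𝓖 ∷ 𝓖s) =
  trans (cong (ρ t (A ∷ 𝓖) +_) (sum-ρ-map-∷ t A 𝓖s)) (+-interchange (degree t A 𝓖) _ _ _)

ρ-deletions : ∀ t (𝓕 : List (Subset n)) →
              sum (map (ρ t) (deletions 𝓕)) + 2 * ρ t 𝓕 ≡ length 𝓕 * ρ t 𝓕
ρ-deletions t []      = refl
ρ-deletions t (A ∷ 𝓕) = begin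
  ρ t 𝓕 + sum (map (ρ t) (map (A ∷_) (deletions 𝓕))) + 2 * (d + ρ t 𝓕)
    ≡⟨ cong (λ u → ρ t 𝓕 + u + 2 * (d + ρ t 𝓕)) (sum-ρ-map-∷ t A (deletions 𝓕)) ⟩
  ρ t 𝓕 + (Σd + Σρ) + 2 * (d + ρ t 𝓕)
    ≡⟨ regroup (ρ t 𝓕) Σd Σρ d ⟩
  ρ t 𝓕 + (Σd + d) + d + (Σρ + 2 * ρ t 𝓕)
    ≡⟨ cong₂ (λ u v → ρ t 𝓕 + u + d + v)
             (length-filter-deletions (λ B → ∣ A ∩ B ∣ ≟ t) 𝓕) (ρ-deletions t 𝓕) ⟩
  ρ t 𝓕 + length 𝓕 * d + d + length 𝓕 * ρ t 𝓕
    ≡⟨ collect (ρ t 𝓕) (length 𝓕) d ⟩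
  suc (length 𝓕) * (d + ρ t 𝓕) ∎
  where
  open ≡-Reasoning
  d = degree t A 𝓕
  Σd = sum (map (degree t A) (deletions 𝓕))
  Σρ = sum (map (ρ t) (deletions 𝓕))
  regroup : ∀ r a b d → r + (a + b) + 2 * (d + r) ≡ r + (a + d) + d + (b + 2 * r)
  regroup = solve-∀
  collect : ∀ r l d → r + l * d + d + l * r ≡ suc l * (d + r)
  collect = solve-∀

∃-≤-average : ∀ {A : Set} (f : A → ℕ) xs → 0 < length xs →
              ∃ λ x → x ∈ xs × length xs * f x ≤ sum (map f xs)
∃-≤-average f (x ∷ [])     _ = x , here refl , ≤-refl
∃-≤-average f (x ∷ y ∷ xs) _ with ∃-≤-average f (y ∷ xs) (s≤s z≤n)
... | z , z∈ , avg with f x ≤? f z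
...   | yes fx≤fz = x , here refl , +-monoʳ-≤ (f x) (≤-trans (*-monoʳ-≤ (length (y ∷ xs)) fx≤fz) avg)
...   | no  fx≰fz = z , there z∈ , +-mono-≤ (<⇒≤ (≰⇒> fx≰fz)) avg

sparser-deletion : ∀ t (𝓕 : List (Subset n)) → 0 < length 𝓕 →
  ∃ λ 𝓖 → 𝓖 ∈ deletions 𝓕 × length 𝓕 * ρ t 𝓖 + 2 * ρ t 𝓕 ≤ length 𝓕 * ρ t 𝓕
sparser-deletion t 𝓕 0<∣𝓕∣
  with ∃-≤-average (ρ t) (deletions 𝓕) (subst (0 <_) (sym (length-deletions 𝓕)) 0<∣𝓕∣)
... | 𝓖 , 𝓖∈ , avg = 𝓖 , 𝓖∈ , (begin
  length 𝓕 * ρ t 𝓖 + 2 * ρ t 𝓕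
    ≡⟨ cong (λ l → l * ρ t 𝓖 + 2 * ρ t 𝓕) (length-deletions 𝓕) ⟨
  length (deletions 𝓕) * ρ t 𝓖 + 2 * ρ t 𝓕          ≤⟨ +-monoˡ-≤ (2 * ρ t 𝓕) avg ⟩
  sum (map (ρ t) (deletions 𝓕)) + 2 * ρ t 𝓕          ≡⟨ ρ-deletions t 𝓕 ⟩
  length 𝓕 * ρ t 𝓕                                   ∎)
  where open ≤-Reasoning

thinning-step : ∀ {s a b c L} → 0 < s → suc s * b + 2 * c ≤ suc s * c →
                a * (s * s) ≤ L * b → a * (suc s * suc s) ≤ L * c
thinning-step {suc u} {a} {b} {c} {L} _ sparser ih = *-cancelʳ-≤ _ _ (T * T) (begin
  a * (S * S) * (T * T)  ≡⟨ xy∙z≈y∙xz a (S * S) (T * T) ⟩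
  S * S * (a * (T * T))  ≤⟨ *-monoʳ-≤ (S * S) ih ⟩
  S * S * (L * b)        ≡⟨ *-interchange S S L b ⟩
  S * L * (S * b)        ≤⟨ *-monoʳ-≤ (S * L) Sb≤uc ⟩
  S * L * (u * c)        ≡⟨ *-interchange S L u c ⟩
  S * u * (L * c)        ≤⟨ *-monoˡ-≤ (L * c) (≤-trans (n≤1+n (S * u)) (≤-reflexive (square-suc u))) ⟩
  T * T * (L * c)        ≡⟨ *-comm (T * T) (L * c) ⟩
  L * c * (T * T)        ∎)
  where
  open ≤-Reasoning
  S = 2 + u
  T = 1 + u
  Sb≤uc : S * b ≤ u * c
  Sb≤uc = +-cancelʳ-≤ (2 * c) _ _
            (≤-trans sparser (≤-reflexive (trans (*-distribʳ-+ c 2 u) (+-comm (2 * c) (u * c)))))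
  square-suc : ∀ u → suc ((2 + u) * u) ≡ (1 + u) * (1 + u)
  square-suc = solve-∀

sparse-subfamily : ∀ {k} t ℓ d (𝓕 : List (Subset n)) → IsFamily n k 𝓕 → d + ℓ ≡ length 𝓕 →
                   ρℓ≤ n k t ℓ (λ r → r * (length 𝓕 * length 𝓕) ≤ ℓ * ℓ * ρ t 𝓕)
sparse-subfamily t zero      d       𝓕 _   _   = [] , ([] , []) , refl , z≤n
sparse-subfamily t (suc ℓ)   zero    𝓕 fam len =
  𝓕 , fam , sym len ,
  subst (λ N → ρ t 𝓕 * (N * N) ≤ suc ℓ * suc ℓ * ρ t 𝓕) len (≤-reflexive (*-comm (ρ t 𝓕) _))
sparse-subfamily t ℓ@(suc _) (suc d) 𝓕 fam len =
  let 𝓖 , 𝓖∈ , sparser = sparser-deletion t 𝓕 (subst (0 <_) len (s≤s z≤n))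
      ∣𝓕∣≡1+∣𝓖∣       = sym (∈-deletions⇒length 𝓖∈)
      ∣𝓖∣≡d+ℓ          = suc-injective (trans len ∣𝓕∣≡1+∣𝓖∣)
      𝓗 , fam𝓗 , ∣𝓗∣≡ℓ , thin = sparse-subfamily t ℓ d 𝓖 (IsFamily-deletions 𝓖∈ fam) ∣𝓖∣≡d+ℓ
  in 𝓗 , fam𝓗 , ∣𝓗∣≡ℓ ,
     subst (λ N → ρ t 𝓗 * (N * N) ≤ ℓ * ℓ * ρ t 𝓕) (sym ∣𝓕∣≡1+∣𝓖∣)
       (thinning-step {length 𝓖} {ρ t 𝓗} {ρ t 𝓖} {ρ t 𝓕} {ℓ * ℓ}
                      (subst (0 <_) ∣𝓖∣≡d+ℓ (≤-trans (s≤s z≤n) (m≤n+m ℓ d)))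
                      (subst (λ N → N * ρ t 𝓖 + 2 * ρ t 𝓕 ≤ N * ρ t 𝓕) ∣𝓕∣≡1+∣𝓖∣ sparser)
                      thin)

ρℓ≤-map : ∀ {k t ℓ} {P Q : ℕ → Set} → (∀ r → P r → Q r) → ρℓ≤ n k t ℓ P → ρℓ≤ n k t ℓ Q
ρℓ≤-map P⇒Q (𝓕 , fam , len , p) = 𝓕 , fam , len , P⇒Q _ p

m*n*n≤o*n⇒m*n≤o : ∀ m n o → m * n * n ≤ o * n → m * n ≤ o
m*n*n≤o*n⇒m*n≤o m zero    o _ = subst (_≤ o) (sym (*-zeroʳ m)) z≤n
m*n*n≤o*n⇒m*n≤o m (suc n) o p = *-cancelʳ-≤ (m * suc n) o (suc n) p

sparse-family : ∀ {k t ℓ} → ℓ ≤ n C k →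
  ρℓ≤ n k t ℓ (λ r → 2 * r * (n C k) ≤ ℓ * ℓ * ((k C t) * (n C (k ∸ t))))
sparse-family {n} {k} {t} {ℓ} ℓ≤
  rewrite sym (choose≡C n k) | sym (choose≡C k t) | sym (choose≡C n (k ∸ t)) =
  ρℓ≤-map expected-count
    (sparse-subfamily t ℓ (N ∸ ℓ) (subsets n k) (subsets-family n k)
                      (trans (m∸n+n≡m ℓ≤) (sym (length-subsets n k))))
  where
  open ≤-Reasoning
  N = n choose k
  D = (k choose t) * (n choose (k ∸ t))
  expected-count : ∀ r → r * (length (subsets n k) * length (subsets n k)) ≤ ℓ * ℓ * ρ t (subsets n k) →
                   2 * r * N ≤ ℓ * ℓ * D
  expected-count r thin rewrite length-subsets n k = m*n*n≤o*n⇒m*n≤o (2 * r) N (ℓ * ℓ * D) (begin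
    2 * r * N * N                  ≡⟨ trans (*-assoc (2 * r) N N) (*-assoc 2 r (N * N)) ⟩
    2 * (r * (N * N))              ≤⟨ *-monoʳ-≤ 2 thin ⟩
    2 * (ℓ * ℓ * ρ t (subsets n k)) ≡⟨ x∙yz≈y∙xz 2 (ℓ * ℓ) _ ⟩
    ℓ * ℓ * (2 * ρ t (subsets n k)) ≤⟨ *-monoʳ-≤ (ℓ * ℓ) (ρ-subsets n k t) ⟩
    ℓ * ℓ * (N * D)                ≡⟨ cong (ℓ * ℓ *_) (*-comm N D) ⟩
    ℓ * ℓ * (D * N)                ≡⟨ *-assoc (ℓ * ℓ) D N ⟨
    ℓ * ℓ * D * N                  ∎)

cross-multiply-≤ : ∀ {x y p q r L B D N} → 0 < N → 2 * r * N ≤ L * (B * D) →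
                   p * x * (B * D) ≤ q * y * (B * B) * N → 2 * x * p * r ≤ q * L * y * (B * B)
cross-multiply-≤ {x} {y} {p} {q} {r} {L} {B} {D} {N} 0<N 2rN≤ pxBD≤ = *-cancelʳ-≤ _ _ N {{>-nonZero 0<N}} (begin
  2 * x * p * r * N          ≡⟨ regroup₁ x p r N ⟩
  p * x * (2 * r * N)        ≤⟨ *-monoʳ-≤ (p * x) 2rN≤ ⟩
  p * x * (L * (B * D))      ≡⟨ x∙yz≈y∙xz (p * x) L (B * D) ⟩
  L * (p * x * (B * D))      ≤⟨ *-monoʳ-≤ L pxBD≤ ⟩
  L * (q * y * (B * B) * N)  ≡⟨ regroup₂ L q y (B * B) N ⟩
  q * L * y * (B * B) * N    ∎)
  where
  open ≤-Reasoning
  regroup₁ : ∀ x p r N → 2 * x * p * r * N ≡ p * x * (2 * r * N)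
  regroup₁ = solve-∀
  regroup₂ : ∀ L q y b N → L * (q * y * b * N) ≡ q * L * y * b * N
  regroup₂ = solve-∀

claim2 : (k t : ℕ) → 1 ≤ k → 1 ≤ t → (m : ℕ) →
    ∃ λ (N : ℕ) → (n : ℕ) → n ≥ N → (ℓ : ℕ) →
      α<_ {n} {k} {t} ℓ → ℓ ≤ n C k →
      ρℓ≤ n k t ℓ (λ r →
        2 * (n ^ t) * suc m * r ≤ suc (suc m) * (ℓ * ℓ) * (t !) * ((k C t) * (k C t)))
claim2 k t _ _ m = N , λ n N≤n ℓ _ ℓ≤nCk →
  ρℓ≤-map (λ r 2rN≤ → cross-multiply-≤ {n ^ t} {t !} {suc m} {suc (suc m)} {r} {ℓ * ℓ} {k C t}
                         (k≤n⇒0<nCk (≤-trans (m≤n+m k _) N≤n)) 2rN≤ (degree-asymptotics m k t n N≤n))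
          (sparse-family {t = t} ℓ≤nCk)
  where
  N = suc (suc m) * k * k + k
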